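{- For every $\mathsf{QMLL}$ proof $\pi$, the semantics $[\![\pi]\!]$ is total: for every initial state $S$ of $\pi$ there is a final state $T$ of $\pi$ with $S\to_\pi^*T$.
   Context: $\mathsf{QMLL}$ formulas: $A ::= \alpha \mid \alpha^\perp \mid A\wp A \mid A\otimes A \mid \boxdot A \mid \Diamond A$ ($\alpha$ atoms; $\wp$ = par, $\otimes$ = tensor; $\boxdot,\Diamond$ dual modalities); negation: $(\alpha^\perp)^\perp=\alpha$, $(A\otimes B)^\perp=A^\perp\wp B^\perp$, $(A\wp B)^\perp=A^\perp\otimes B^\perp$, $(\boxdot A)^\perp=\Diamond A^\perp$, $(\Diamond A)^\perp=\boxdot A^\perp$; $\boxdot^nA,\Diamond^nA$ are $n$-fold prefixes; modal formulas are those of the form $\boxdot A$ or $\Diamond A$. $\mathcal U_n$ = unitary operators on $\mathbb C^{2^n}$. Rules: axiom $\vdash A^\perp,A$; cut: from $\vdash\Gamma,A$, $\vdash\Delta,A^\perp$ infer $\vdash\Gamma,\Delta$; par: from $\vdash\Gamma,A,B$ infer $\vdash\Gamma,A\wp B$; tensor: from $\vdash\Gamma,A$, $\vdash\Delta,B$ infer $\vdash\Gamma,\Delta,A\otimes B$; quantum rule $\mathsf{Q}_n$ labelled by $U\in\mathcal U_n$: from $\vdash A,B$ infer $\vdash\Diamond^nA,\boxdot^nB$, provided $A,B$ both modal or both non-modal. Proofs are finite trees of rule instances; formulas in them are considered as occurrences. A context is a formula with one hole: $C ::= [\cdot] \mid C\wp A \mid A\wp C \mid C\otimes A \mid A\otimes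 C \mid \boxdot C \mid \Diamond C$; $C[A]$ is the result of filling the hole with $A$. $C$ is a positive (resp. negative) context for $A$ if $A=C[\alpha]$ (resp. $A=C[\alpha^\perp]$) for an atom $\alpha$; letters $P$ and $N$ denote positive resp. negative contexts. The dual $C^\perp$ is defined by De Morgan (e.g. $(A\otimes C)^\perp=A^\perp\wp C^\perp$, $(\boxdot C)^\perp=\Diamond C^\perp$, $[\cdot]^\perp=[\cdot]$). The nesting depth $d(C)$ is the number of modal operators enclosing the hole. A stack is a finite word over $\{\boxdot,\Diamond\}$; $|s|$ its length, $\varepsilon$ the empty stack. A state of $\pi$ is a quadruple $(A,C,s,Q)$ with $A$ a formula occurrence in $\pi$, $C$ a context for $A$, $s$ a stack and $Q$ a quantum register of $d(C)+|s|$ qubits (a unit vector of $\mathbb C^{2^{d(C)+|s|}}$). The transition relation $\to_\pi$ is defined locally for each rule instance of $\pi$ as follows (in each rule, a formula occurrence of a premise and the corresponding occurrence of the conclusion are distinguished by subscripts 2 and 1; "context formulas" are the non-principal ones): Axiom $\vdash A^\perp,A$: $(A,N,s,Q)\to(A^\perp,N^\perp,s,Q)$ and $(A^\perp,N,s,Q)\to(A,N^\perp,s,Q)$. Cut from $\vdash\Gamma_2,A$ and $\vdash\Delta_2,A^\perp$ to $\vdash\Gamma_1,\Delta_1$: $(A,P,s,Q)\to(A^\perp,P^\perp,s,Q)$, $(A^\perp,P,s,Q)\to(A,P^\perp,s,Q)$; for each context formula, $(X_1,N,s,Q)\to(X_2,N,s,Q)$ and $(X_2,P,s,Q)\to(X_1,P,s,Q)$.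 Par from $\vdash\Gamma_2,A,B$ to $\vdash\Gamma_1,A\wp B$ (resp. tensor from $\vdash\Gamma_2,A$, $\vdash\Delta_2,B$ to $\vdash\Gamma_1,\Delta_1,A\otimes B$), writing $\star$ for $\wp$ (resp. $\otimes$): $(A\star B,N\star B,s,Q)\to(A,N,s,Q)$; $(A\star B,A\star N,s,Q)\to(B,N,s,Q)$; $(A,P,s,Q)\to(A\star B,P\star B,s,Q)$; $(B,P,s,Q)\to(A\star B,A\star P,s,Q)$; context formulas pass through as for cut. Quantum rule $\mathsf{Q}_n$ with label $U$, premise $\vdash A,B$, conclusion $\vdash\Diamond^nA,\boxdot^nB$: $(\Diamond^nA,\Diamond^nN,s,Q)\to(A,N,s\cdot\Diamond^n,Q)$; $(\boxdot^nB,\boxdot^nN,s,Q)\to(B,N,s\cdot\boxdot^n,Q)$; $(A,P,s\cdot\Diamond^n,Q)\to(\Diamond^nA,\Diamond^nP,s,Q)$; $(A,P,s\cdot\boxdot^n,Q)\to(\Diamond^nA,\Diamond^nP,s,(I_{d(P)}\otimes U^*\otimes I_{|s|})(Q))$; $(B,P,s\cdot\boxdot^n,Q)\to(\boxdot^nB,\boxdot^nP,s,Q)$; $(B,P,s\cdot\Diamond^n,Q)\to(\boxdot^nB,\boxdot^nP,s,(I_{d(P)}\otimes U\otimes I_{|s|})(Q))$, where $I_k$ is the identity on $\mathbb C^{2^k}$ and $U^*$ the adjoint of $U$. $\to_\pi^*$ is the reflexive-transitive closure of $\to_\pi$. The initial states of $\pi$ are the states $(A,N,\varepsilon,Q)$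 with $A$ a formula occurrence in the conclusion sequent of $\pi$ and $N$ a negative context for $A$; the final states are the states $(A,P,\varepsilon,Q)$ with $A$ in the conclusion of $\pi$ and $P$ positive for $A$. The semantics $[\![\pi]\!]$ is the partial function from initial to final states with $[\![\pi]\!](S)=T$ iff $S\to_\pi^*T$. -}

module Defs where

open import Data.Nat using (ℕ; zero; suc; _+_)
open import Data.Nat.Properties using (+-assoc; +-comm; +-suc)
open import Data.Bool using (Bool; true; false)
open import Data.List using (List; []; _∷_; _++_; length; replicate)
open import Data.List.Properties using (length-++; length-replicate)
open import Data.List.Membership.Propositional using (_∈_)
open import Data.List.Relation.Unary.Any using (here; there)
open import Data.List.Relation.Unary.Any.Properties using (++⁺ˡ; ++⁺ʳ)
open import Data.Product using (Σ; Σ-syntax; _×_; _,_)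
open import Relation.Binary.PropositionalEquality

infixr 6 _⅋_ _⊗_

data Formula : Set where
  atom  : ℕ → Formula
  natom : ℕ → Formula
  _⅋_   : Formula → Formula → Formula
  _⊗_   : Formula → Formula → Formula
  ⊡     : Formula → Formula
  ◇     : Formula → Formula

_⊥ : Formula → Formula
atom a ⊥  = natom a
natom a ⊥ = atom a
(A ⅋ B) ⊥ = (A ⊥) ⊗ (B ⊥)
(A ⊗ B) ⊥ = (A ⊥) ⅋ (B ⊥)
⊡ A ⊥     = ◇ (A ⊥)
◇ A ⊥     = ⊡ (A ⊥)

◇^ : ℕ → Formula → Formula
◇^ zero A    = A
◇^ (suc n) A = ◇ (◇^ n A)

⊡^ : ℕ → Formula → Formula
⊡^ zero A    = A
⊡^ (suc n) A = ⊡ (⊡^ n A)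

isModal : Formula → Bool
isModal (⊡ _) = true
isModal (◇ _) = true
isModal _     = false

data Ctx : Set where
  hole : Ctx
  _⅋ₗ_ : Ctx → Formula → Ctx
  _⅋ᵣ_ : Formula → Ctx → Ctx
  _⊗ₗ_ : Ctx → Formula → Ctx
  _⊗ᵣ_ : Formula → Ctx → Ctx
  ⊡c   : Ctx → Ctx
  ◇c   : Ctx → Ctx

fill : Ctx → Formula → Formula
fill hole X     = X
fill (C ⅋ₗ A) X = fill C X ⅋ A
fill (A ⅋ᵣ C) X = A ⅋ fill C X
fill (C ⊗ₗ A) X = fill C X ⊗ A
fill (A ⊗ᵣ C) X = A ⊗ fill C X
fill (⊡c C) X   = ⊡ (fill C X)
fill (◇c C) X   = ◇ (fill C X)

dual : Ctx → Ctx
dual hole     = hole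
dual (C ⅋ₗ A) = dual C ⊗ₗ (A ⊥)
dual (A ⅋ᵣ C) = (A ⊥) ⊗ᵣ dual C
dual (C ⊗ₗ A) = dual C ⅋ₗ (A ⊥)
dual (A ⊗ᵣ C) = (A ⊥) ⅋ᵣ dual C
dual (⊡c C)   = ◇c (dual C)
dual (◇c C)   = ⊡c (dual C)

◇c^ : ℕ → Ctx → Ctx
◇c^ zero C    = C
◇c^ (suc n) C = ◇c (◇c^ n C)

⊡c^ : ℕ → Ctx → Ctx
⊡c^ zero C    = C
⊡c^ (suc n) C = ⊡c (⊡c^ n C)

depth : Ctx → ℕ
depth hole     = zero
depth (C ⅋ₗ _) = depth C
depth (_ ⅋ᵣ C) = depth C
depth (C ⊗ₗ _) = depth C
depth (_ ⊗ᵣ C) = depth C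
depth (⊡c C)   = suc (depth C)
depth (◇c C)   = suc (depth C)

Pos : Ctx → Formula → Set
Pos C A = Σ[ a ∈ ℕ ] fill C (atom a) ≡ A

Neg : Ctx → Formula → Set
Neg C A = Σ[ a ∈ ℕ ] fill C (natom a) ≡ A

data Mod : Set where
  m⊡ m◇ : Mod

Stack : Set
Stack = List Mod

depth-dual : ∀ C → depth (dual C) ≡ depth C
depth-dual hole     = refl
depth-dual (C ⅋ₗ _) = depth-dual C
depth-dual (_ ⅋ᵣ C) = depth-dual C
depth-dual (C ⊗ₗ _) = depth-dual C
depth-dual (_ ⊗ᵣ C) = depth-dual C
depth-dual (⊡c C)   = cong suc (depth-dual C)
depth-dual (◇c C)   = cong suc (depth-dual C)

depth-◇c^ : ∀ n C → depth (◇c^ n C) ≡ n + depth C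
depth-◇c^ zero C    = refl
depth-◇c^ (suc n) C = cong suc (depth-◇c^ n C)

depth-⊡c^ : ∀ n C → depth (⊡c^ n C) ≡ n + depth C
depth-⊡c^ zero C    = refl
depth-⊡c^ (suc n) C = cong suc (depth-⊡c^ n C)

push-size : ∀ d n (s : Stack) x → d + length (s ++ replicate n x) ≡ d + n + length s
push-size d n s x = begin
    d + length (s ++ replicate n x)
  ≡⟨ cong (d +_) (length-++ s) ⟩
    d + (length s + length (replicate n x))
  ≡⟨ cong (λ k → d + (length s + k)) (length-replicate n) ⟩
    d + (length s + n)
  ≡⟨ cong (d +_) (+-comm (length s) n) ⟩
    d + (n + length s)
  ≡⟨ sym (+-assoc d n (length s)) ⟩
    d + n + length s
  ∎ where open ≡-Reasoning

◇-size : ∀ n C (s : Stack) → depth (◇c^ n C) + length s ≡ depth C + n + length s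
◇-size n C s = trans (cong (_+ length s) (trans (depth-◇c^ n C) (+-comm n (depth C)))) refl

⊡-size : ∀ n C (s : Stack) → depth (⊡c^ n C) + length s ≡ depth C + n + length s
⊡-size n C s = trans (cong (_+ length s) (trans (depth-⊡c^ n C) (+-comm n (depth C)))) refl

-- Reg k   : quantum registers of k qubits (unit vectors of ℂ^(2^k))
-- Unitary n : the unitary operators 𝒰ₙ on ℂ^(2^n)
-- adj U   : the adjoint U*
-- apply a U b : the operator I_a ⊗ U ⊗ I_b on ℂ^(2^(a+n+b))

record QStruct : Set₁ where
  field
    Reg     : ℕ → Set
    Unitary : ℕ → Set
    adj     : ∀ {n} → Unitary n → Unitary n
    apply   : (a : ℕ) {n : ℕ} → Unitary n → (b : ℕ) → Reg (a + n + b) → Reg (a + n + b)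

swap∈ : ∀ {X : Formula} Γ {A B Δ} → X ∈ Γ ++ A ∷ B ∷ Δ → X ∈ Γ ++ B ∷ A ∷ Δ
swap∈ [] (here p)           = there (here p)
swap∈ [] (there (here p))   = here p
swap∈ [] (there (there i))  = there (there i)
swap∈ (_ ∷ Γ) (here p)      = here p
swap∈ (_ ∷ Γ) (there i)     = there (swap∈ Γ i)

module QMLL (QS : QStruct) where
  open QStruct QS

  cast : ∀ {m n} → m ≡ n → Reg m → Reg n
  cast = subst Reg

  -- QMLL proofs, indexed by their conclusion sequent.  Sequents are lists;
  -- principal formulas are put in front and an explicit exchange rule
  -- makes the order of the sequent immaterial.
  data Proof : List Formula → Set where
    ax  : (A : Formula) → Proof (A ⊥ ∷ A ∷ [])
    cut : ∀ {A Γ Δ} → Proof (A ∷ Γ) → Proof (A ⊥ ∷ Δ) → Proof (Γ ++ Δ)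
    par : ∀ {A B Γ} → Proof (A ∷ B ∷ Γ) → Proof (A ⅋ B ∷ Γ)
    ten : ∀ {A B Γ Δ} → Proof (A ∷ Γ) → Proof (B ∷ Δ) → Proof (A ⊗ B ∷ Γ ++ Δ)
    qr  : ∀ {A B} (n : ℕ) (U : Unitary (suc n)) → isModal A ≡ isModal B →
          Proof (A ∷ B ∷ []) → Proof (◇^ (suc n) A ∷ ⊡^ (suc n) B ∷ [])
    ex  : ∀ Γ {A B Δ} → Proof (Γ ++ A ∷ B ∷ Δ) → Proof (Γ ++ B ∷ A ∷ Δ)

  data Occ : ∀ {Γ} → Proof Γ → Formula → Set where
    concl : ∀ {Γ} {π : Proof Γ} {X} → X ∈ Γ → Occ π X
    cut₁  : ∀ {A Γ Δ} {p : Proof (A ∷ Γ)} {q : Proof (A ⊥ ∷ Δ)} {X} → Occ p X → Occ (cut p q) X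
    cut₂  : ∀ {A Γ Δ} {p : Proof (A ∷ Γ)} {q : Proof (A ⊥ ∷ Δ)} {X} → Occ q X → Occ (cut p q) X
    par↑  : ∀ {A B Γ} {p : Proof (A ∷ B ∷ Γ)} {X} → Occ p X → Occ (par p) X
    ten₁  : ∀ {A B Γ Δ} {p : Proof (A ∷ Γ)} {q : Proof (B ∷ Δ)} {X} → Occ p X → Occ (ten p q) X
    ten₂  : ∀ {A B Γ Δ} {p : Proof (A ∷ Γ)} {q : Proof (B ∷ Δ)} {X} → Occ q X → Occ (ten p q) X
    qr↑   : ∀ {A B n U e} {p : Proof (A ∷ B ∷ [])} {X} → Occ p X → Occ (qr n U e p) X
    ex↑   : ∀ {Γ A B Δ} {p : Proof (Γ ++ A ∷ B ∷ Δ)} {X} → Occ p X → Occ (ex Γ p) X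

  record State {Γ} (π : Proof Γ) : Set where
    constructor st
    field
      fm    : Formula
      occ   : Occ π fm
      ctx   : Ctx
      stack : Stack
      reg   : Reg (depth ctx + length stack)

  mapState : ∀ {Γ Δ} {p : Proof Γ} {π : Proof Δ} →
             (∀ {X} → Occ p X → Occ π X) → State p → State π
  mapState f (st A o C s Q) = st A (f o) C s Q

  -- correspondence between an occurrence of a context formula in the
  -- conclusion (first) and in a premise (second) of a rule instance
  data Corr : ∀ {Γ} (π : Proof Γ) {X} → Occ π X → Occ π X → Set where
    cutΓ : ∀ {A Γ Δ} {p : Proof (A ∷ Γ)} {q : Proof (A ⊥ ∷ Δ)} {X} (i : X ∈ Γ) →
           Corr (cut p q) (concl (++⁺ˡ i)) (cut₁ (concl (there i)))
    cutΔ : ∀ {A Γ Δ} {p : Proof (A ∷ Γ)} {q : Proof (A ⊥ ∷ Δ)} {X} (j : X ∈ Δ) →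
           Corr (cut p q) (concl (++⁺ʳ Γ j)) (cut₂ (concl (there j)))
    parΓ : ∀ {A B Γ} {p : Proof (A ∷ B ∷ Γ)} {X} (i : X ∈ Γ) →
           Corr (par p) (concl (there i)) (par↑ (concl (there (there i))))
    tenΓ : ∀ {A B Γ Δ} {p : Proof (A ∷ Γ)} {q : Proof (B ∷ Δ)} {X} (i : X ∈ Γ) →
           Corr (ten p q) (concl (there (++⁺ˡ i))) (ten₁ (concl (there i)))
    tenΔ : ∀ {A B Γ Δ} {p : Proof (A ∷ Γ)} {q : Proof (B ∷ Δ)} {X} (j : X ∈ Δ) →
           Corr (ten p q) (concl (there (++⁺ʳ Γ j))) (ten₂ (concl (there j)))
    exC  : ∀ {Γ A B Δ} {p : Proof (Γ ++ A ∷ B ∷ Δ)} {X} (i : X ∈ Γ ++ A ∷ B ∷ Δ) →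
           Corr (ex Γ p) (concl (swap∈ Γ i)) (ex↑ (concl i))

  data Step : ∀ {Γ} (π : Proof Γ) → State π → State π → Set where
    pass↓ : ∀ {Γ} {π : Proof Γ} {X} {o₁ o₂ : Occ π X} {N s Q} →
            Corr π o₁ o₂ → Neg N X → Step π (st X o₁ N s Q) (st X o₂ N s Q)
    pass↑ : ∀ {Γ} {π : Proof Γ} {X} {o₁ o₂ : Occ π X} {P s Q} →
            Corr π o₁ o₂ → Pos P X → Step π (st X o₂ P s Q) (st X o₁ P s Q)
    axA  : ∀ {A N s Q} → Neg N A →
           Step (ax A) (st A (concl (there (here refl))) N s Q)
                       (st (A ⊥) (concl (here refl)) (dual N) s
                           (cast (cong (_+ length s) (sym (depth-dual N))) Q))
    axA⊥ : ∀ {A N s Q} → Neg N (A ⊥) →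
           Step (ax A) (st (A ⊥) (concl (here refl)) N s Q)
                       (st A (concl (there (here refl))) (dual N) s
                           (cast (cong (_+ length s) (sym (depth-dual N))) Q))
    cutA  : ∀ {A Γ Δ} {p : Proof (A ∷ Γ)} {q : Proof (A ⊥ ∷ Δ)} {P s Q} → Pos P A →
            Step (cut p q) (st A (cut₁ (concl (here refl))) P s Q)
                           (st (A ⊥) (cut₂ (concl (here refl))) (dual P) s
                               (cast (cong (_+ length s) (sym (depth-dual P))) Q))
    cutA⊥ : ∀ {A Γ Δ} {p : Proof (A ∷ Γ)} {q : Proof (A ⊥ ∷ Δ)} {P s Q} → Pos P (A ⊥) →
            Step (cut p q) (st (A ⊥) (cut₂ (concl (here refl))) P s Q)
                           (st A (cut₁ (concl (here refl))) (dual P) s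
                               (cast (cong (_+ length s) (sym (depth-dual P))) Q))
    par↓ₗ : ∀ {A B Γ} {p : Proof (A ∷ B ∷ Γ)} {N s Q} → Neg N A →
            Step (par p) (st (A ⅋ B) (concl (here refl)) (N ⅋ₗ B) s Q)
                         (st A (par↑ (concl (here refl))) N s Q)
    par↓ᵣ : ∀ {A B Γ} {p : Proof (A ∷ B ∷ Γ)} {N s Q} → Neg N B →
            Step (par p) (st (A ⅋ B) (concl (here refl)) (A ⅋ᵣ N) s Q)
                         (st B (par↑ (concl (there (here refl)))) N s Q)
    par↑ₗ : ∀ {A B Γ} {p : Proof (A ∷ B ∷ Γ)} {P s Q} → Pos P A →
            Step (par p) (st A (par↑ (concl (here refl))) P s Q)
                         (st (A ⅋ B) (concl (here refl)) (P ⅋ₗ B) s Q)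
    par↑ᵣ : ∀ {A B Γ} {p : Proof (A ∷ B ∷ Γ)} {P s Q} → Pos P B →
            Step (par p) (st B (par↑ (concl (there (here refl)))) P s Q)
                         (st (A ⅋ B) (concl (here refl)) (A ⅋ᵣ P) s Q)
    ten↓ₗ : ∀ {A B Γ Δ} {p : Proof (A ∷ Γ)} {q : Proof (B ∷ Δ)} {N s Q} → Neg N A →
            Step (ten p q) (st (A ⊗ B) (concl (here refl)) (N ⊗ₗ B) s Q)
                           (st A (ten₁ (concl (here refl))) N s Q)
    ten↓ᵣ : ∀ {A B Γ Δ} {p : Proof (A ∷ Γ)} {q : Proof (B ∷ Δ)} {N s Q} → Neg N B →
            Step (ten p q) (st (A ⊗ B) (concl (here refl)) (A ⊗ᵣ N) s Q)
                           (st B (ten₂ (concl (here refl))) N s Q)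
    ten↑ₗ : ∀ {A B Γ Δ} {p : Proof (A ∷ Γ)} {q : Proof (B ∷ Δ)} {P s Q} → Pos P A →
            Step (ten p q) (st A (ten₁ (concl (here refl))) P s Q)
                           (st (A ⊗ B) (concl (here refl)) (P ⊗ₗ B) s Q)
    ten↑ᵣ : ∀ {A B Γ Δ} {p : Proof (A ∷ Γ)} {q : Proof (B ∷ Δ)} {P s Q} → Pos P B →
            Step (ten p q) (st B (ten₂ (concl (here refl))) P s Q)
                           (st (A ⊗ B) (concl (here refl)) (A ⊗ᵣ P) s Q)
    q↓◇  : ∀ {A B n U e} {p : Proof (A ∷ B ∷ [])} {N s Q} → Neg N A →
           Step (qr n U e p)
             (st (◇^ (suc n) A) (concl (here refl)) (◇c^ (suc n) N) s Q)
             (st A (qr↑ (concl (here refl))) N (s ++ replicate (suc n) m◇)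
                 (cast (sym (push-size (depth N) (suc n) s m◇)) (cast (◇-size (suc n) N s) Q)))
    q↓⊡  : ∀ {A B n U e} {p : Proof (A ∷ B ∷ [])} {N s Q} → Neg N B →
           Step (qr n U e p)
             (st (⊡^ (suc n) B) (concl (there (here refl))) (⊡c^ (suc n) N) s Q)
             (st B (qr↑ (concl (there (here refl)))) N (s ++ replicate (suc n) m⊡)
                 (cast (sym (push-size (depth N) (suc n) s m⊡)) (cast (⊡-size (suc n) N s) Q)))
    q↑◇◇ : ∀ {A B n U e} {p : Proof (A ∷ B ∷ [])} {P s Q} → Pos P A →
           Step (qr n U e p)
             (st A (qr↑ (concl (here refl))) P (s ++ replicate (suc n) m◇) Q)
             (st (◇^ (suc n) A) (concl (here refl)) (◇c^ (suc n) P) s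
                 (cast (sym (◇-size (suc n) P s)) (cast (push-size (depth P) (suc n) s m◇) Q)))
    q↑◇⊡ : ∀ {A B n U e} {p : Proof (A ∷ B ∷ [])} {P s Q} → Pos P A →
           Step (qr n U e p)
             (st A (qr↑ (concl (here refl))) P (s ++ replicate (suc n) m⊡) Q)
             (st (◇^ (suc n) A) (concl (here refl)) (◇c^ (suc n) P) s
                 (cast (sym (◇-size (suc n) P s))
                   (apply (depth P) (adj U) (length s)
                     (cast (push-size (depth P) (suc n) s m⊡) Q))))
    q↑⊡⊡ : ∀ {A B n U e} {p : Proof (A ∷ B ∷ [])} {P s Q} → Pos P B →
           Step (qr n U e p)
             (st B (qr↑ (concl (there (here refl)))) P (s ++ replicate (suc n) m⊡) Q)
             (st (⊡^ (suc n) B) (concl (there (here refl))) (⊡c^ (suc n) P) s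
                 (cast (sym (⊡-size (suc n) P s)) (cast (push-size (depth P) (suc n) s m⊡) Q)))
    q↑⊡◇ : ∀ {A B n U e} {p : Proof (A ∷ B ∷ [])} {P s Q} → Pos P B →
           Step (qr n U e p)
             (st B (qr↑ (concl (there (here refl)))) P (s ++ replicate (suc n) m◇) Q)
             (st (⊡^ (suc n) B) (concl (there (here refl))) (⊡c^ (suc n) P) s
                 (cast (sym (⊡-size (suc n) P s))
                   (apply (depth P) U (length s)
                     (cast (push-size (depth P) (suc n) s m◇) Q))))
    in-cut₁ : ∀ {A Γ Δ} {p : Proof (A ∷ Γ)} {q : Proof (A ⊥ ∷ Δ)} {S T} →
              Step p S T → Step (cut p q) (mapState cut₁ S) (mapState cut₁ T)
    in-cut₂ : ∀ {A Γ Δ} {p : Proof (A ∷ Γ)} {q : Proof (A ⊥ ∷ Δ)} {S T} →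
              Step q S T → Step (cut p q) (mapState cut₂ S) (mapState cut₂ T)
    in-par  : ∀ {A B Γ} {p : Proof (A ∷ B ∷ Γ)} {S T} →
              Step p S T → Step (par p) (mapState par↑ S) (mapState par↑ T)
    in-ten₁ : ∀ {A B Γ Δ} {p : Proof (A ∷ Γ)} {q : Proof (B ∷ Δ)} {S T} →
              Step p S T → Step (ten p q) (mapState ten₁ S) (mapState ten₁ T)
    in-ten₂ : ∀ {A B Γ Δ} {p : Proof (A ∷ Γ)} {q : Proof (B ∷ Δ)} {S T} →
              Step q S T → Step (ten p q) (mapState ten₂ S) (mapState ten₂ T)
    in-qr   : ∀ {A B n U e} {p : Proof (A ∷ B ∷ [])} {S T} →
              Step p S T → Step (qr n U e p) (mapState qr↑ S) (mapState qr↑ T)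
    in-ex   : ∀ {Γ A B Δ} {p : Proof (Γ ++ A ∷ B ∷ Δ)} {S T} →
              Step p S T → Step (ex Γ p) (mapState ex↑ S) (mapState ex↑ T)

  Initial : ∀ {Γ} (π : Proof Γ) → State π → Set
  Initial {Γ} π (st A o C s Q) = Σ[ i ∈ A ∈ Γ ] (o ≡ concl i) × (s ≡ []) × Neg C A

  Final : ∀ {Γ} (π : Proof Γ) → State π → Set
  Final {Γ} π (st A o C s Q) = Σ[ i ∈ A ∈ Γ ] (o ≡ concl i) × (s ≡ []) × Pos C A

module Submission where

open import Defs
open import Data.Nat using (ℕ; zero; suc; _+_; _<_; _≤_; s≤s)
open import Data.Nat.Properties using (n<1+n; <⇒≤; <-trans)
open import Data.Fin using (Fin; toℕ; _↑ˡ_; _↑ʳ_; splitAt)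
open import Data.Fin.Properties
  using (pigeonhole; toℕ<n; suc-injective; ↑ˡ-injective; ↑ʳ-injective; splitAt-↑ˡ; splitAt-↑ʳ)
open import Data.List using (List; []; _∷_; _++_; length; replicate)
open import Data.List.Membership.Propositional using (_∈_)
open import Data.List.Relation.Unary.Any using (here; there; index)
open import Data.List.Relation.Unary.Any.Properties using (++⁺ˡ; ++⁺ʳ; ++⁻; ++⁻∘++⁺)
open import Data.Sum using (_⊎_; inj₁; inj₂)
import Data.Sum as Sum
open import Data.Sum.Properties using (inj₁-injective; inj₂-injective)
open import Data.Product using (Σ; _×_; _,_; proj₁; proj₂)
open import Data.Empty using (⊥-elim)
open import Function using (_∘_)
open import Relation.Nullary using (¬_)
open import Relation.Binary.PropositionalEquality
open import Relation.Binary.Construct.Closure.ReflexiveTransitive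
  using (Star; ε; _◅_; _◅◅_; gmap)
open import Axiom.UniquenessOfIdentityProofs.WithK using (uip)

-- We prove a stronger, compositional statement.  A *behaviour* of a proof π
-- is an injective map sending every entry port of its conclusion (a formula
-- occurrence with a negative context) to an exit port (a positive context),
-- such that for every stack s and register Q the machine runs from the entry
-- with (s, Q) to the exit with the same stack s and some register.  Being
-- uniform in the stack lets the quantum rule push modalities onto it;
-- injectivity is what makes cuts terminate.
--
-- Axioms are direct; par, exchange
-- and the quantum rule relay the behaviour of their premise through one entry
-- step and one exit step (lemma `relay`); tensor juxtaposes the behaviours of
-- its premises.  At a cut an exit through the cut formula re-enters the other
-- premise; termination is the combinatorial lemma `Orbits.reaches`: iterating
-- an injective map whose successors lie in a finite set (here: the negative
-- contexts of A and A⊥, counted by `hole-index`) from a point outside its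
-- image always leaves the set, and distinct such points leave at distinct
-- outputs.  Proposition 3 is then the behaviour of π run on the empty stack.

module Orbits {T O : Set} (next : T → T ⊎ O)
  (next-injective : ∀ {t t′} → next t ≡ next t′ → t ≡ t′)
  {M : ℕ} (code : T → Fin M)
  (code-injective : ∀ {u u′ t t′} → next u ≡ inj₁ t → next u′ ≡ inj₁ t′ →
                    code t ≡ code t′ → t ≡ t′) where

  _↦_ : T → T → Set
  t ↦ u = next t ≡ inj₁ u

  _↦*_ : T → T → Set
  _↦*_ = Star _↦_

  Reaches : T → O → Set
  Reaches t o = Σ T λ u → t ↦* u × next u ≡ inj₂ o

  Source : T → Set
  Source t = ∀ {u} → ¬ (u ↦ t)

  last-step : ∀ {t v} → t ↦* v → t ≡ v ⊎ Σ T λ w → t ↦* w × w ↦ v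
  last-step ε = inj₁ refl
  last-step (e ◅ r) with last-step r
  ... | inj₁ refl = inj₂ (_ , ε , e)
  ... | inj₂ (w , r′ , e′) = inj₂ (w , e ◅ r′ , e′)

  -- two paths to a common point: one start lies on the path of the other,
  -- since predecessors are unique
  comparable : ∀ {t t′ v} → t ↦* v → t′ ↦* v → t ↦* t′ ⊎ t′ ↦* t
  comparable ε r′ = inj₂ r′
  comparable (e ◅ r) r′ with comparable r r′
  ... | inj₁ r₁ = inj₁ (e ◅ r₁)
  ... | inj₂ r₂ with last-step r₂
  ...   | inj₁ refl = inj₁ (e ◅ ε)
  ...   | inj₂ (w , r₃ , e′) with next-injective (trans e′ (sym e))
  ...     | refl = inj₂ r₃

  source-reached : ∀ {t t′} → Source t′ → t ↦* t′ → t ≡ t′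
  source-reached src r with last-step r
  ... | inj₁ eq = eq
  ... | inj₂ (_ , _ , e) = ⊥-elim (src e)

  reaches-injective : ∀ {t t′ o} → Source t → Source t′ →
                      Reaches t o → Reaches t′ o → t ≡ t′
  reaches-injective src src′ (u , r , e) (u′ , r′ , e′)
    with next-injective (trans e (sym e′))
  ... | refl with comparable r r′
  ...   | inj₁ r₁ = source-reached src′ r₁
  ...   | inj₂ r₂ = sym (source-reached src r₂)

  Chain : ℕ → T → Set
  Chain k t = Σ (ℕ → T) λ c → c 0 ≡ t × (∀ i → i < k → c i ↦ c (suc i))

  walk : ∀ k t → Σ O (Reaches t) ⊎ Chain k t
  walk zero t = inj₂ ((λ _ → t) , refl , λ _ ())
  walk (suc k) t with next t in eq
  ... | inj₂ o = inj₁ (o , t , ε , eq)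
  ... | inj₁ t′ with walk k t′
  ...   | inj₁ (o , u , r , e) = inj₁ (o , u , eq ◅ r , e)
  ...   | inj₂ (c , refl , steps) = inj₂ (c′ , refl , steps′)
    where
      c′ : ℕ → T
      c′ zero = t
      c′ (suc i) = c i
      steps′ : ∀ i → i < suc k → c′ i ↦ c′ (suc i)
      steps′ zero _ = eq
      steps′ (suc i) (s≤s i<k) = steps i i<k

  -- a chain from a source never revisits a point: rewinding a repetition
  -- c_a = c_b (a < b) by injectivity makes c₀ a successor
  chain-distinct : ∀ {k t} → Source t → ((c , _ , _) : Chain k t) →
                   ∀ {a b} → a < b → b ≤ k → c a ≢ c b
  chain-distinct src (c , refl , steps) {zero} {suc b} _ b<k eq =
    src (subst (c b ↦_) (sym eq) (steps b b<k))
  chain-distinct src ch@(c , _ , steps) {suc a} {suc b} (s≤s a<b) b<k eq =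
    chain-distinct src ch a<b (<⇒≤ b<k)
      (next-injective (trans (steps a (<-trans a<b b<k))
                      (trans (cong inj₁ eq) (sym (steps b b<k)))))

  -- a chain of M + 1 steps from a source would repeat a code among its
  -- successors c₁ … c_{M+1} (pigeonhole), hence repeat a point
  no-long-chain : ∀ {t} → Source t → ¬ Chain (suc M) t
  no-long-chain src ch@(c , _ , steps)
    with pigeonhole (n<1+n M) (λ i → code (c (suc (toℕ i))))
  ... | i , j , i<j , same =
    chain-distinct src ch (s≤s i<j) (toℕ<n j)
      (code-injective (steps (toℕ i) (toℕ<n i)) (steps (toℕ j) (toℕ<n j)) same)

  reaches : ∀ {t} → Source t → Σ O (Reaches t)
  reaches {t} src with walk (suc M) t
  ... | inj₁ r = r
  ... | inj₂ ch = ⊥-elim (no-long-chain src ch)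

⊥-involutive : ∀ A → A ⊥ ⊥ ≡ A
⊥-involutive (atom _)  = refl
⊥-involutive (natom _) = refl
⊥-involutive (A ⅋ B)   = cong₂ _⅋_ (⊥-involutive A) (⊥-involutive B)
⊥-involutive (A ⊗ B)   = cong₂ _⊗_ (⊥-involutive A) (⊥-involutive B)
⊥-involutive (⊡ A)     = cong ⊡ (⊥-involutive A)
⊥-involutive (◇ A)     = cong ◇ (⊥-involutive A)

fill-dual : ∀ C F → fill (dual C) (F ⊥) ≡ fill C F ⊥
fill-dual hole     F = refl
fill-dual (C ⅋ₗ A) F = cong (_⊗ A ⊥) (fill-dual C F)
fill-dual (A ⅋ᵣ C) F = cong (A ⊥ ⊗_) (fill-dual C F)
fill-dual (C ⊗ₗ A) F = cong (_⅋ A ⊥) (fill-dual C F)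
fill-dual (A ⊗ᵣ C) F = cong (A ⊥ ⅋_) (fill-dual C F)
fill-dual (⊡c C)   F = cong ◇ (fill-dual C F)
fill-dual (◇c C)   F = cong ⊡ (fill-dual C F)

dual-involutive : ∀ C → dual (dual C) ≡ C
dual-involutive hole     = refl
dual-involutive (C ⅋ₗ A) = cong₂ _⅋ₗ_ (dual-involutive C) (⊥-involutive A)
dual-involutive (A ⅋ᵣ C) = cong₂ _⅋ᵣ_ (⊥-involutive A) (dual-involutive C)
dual-involutive (C ⊗ₗ A) = cong₂ _⊗ₗ_ (dual-involutive C) (⊥-involutive A)
dual-involutive (A ⊗ᵣ C) = cong₂ _⊗ᵣ_ (⊥-involutive A) (dual-involutive C)
dual-involutive (⊡c C)   = cong ⊡c (dual-involutive C)
dual-involutive (◇c C)   = cong ◇c (dual-involutive C)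

dual-injective : ∀ {C C′} → dual C ≡ dual C′ → C ≡ C′
dual-injective {C} {C′} eq =
  trans (sym (dual-involutive C)) (trans (cong dual eq) (dual-involutive C′))

Neg⇒Pos-dual : ∀ {N X} → Neg N X → Pos (dual N) (X ⊥)
Neg⇒Pos-dual {N} (a , eq) = a , trans (fill-dual N (natom a)) (cong _⊥ eq)

Pos⇒Neg-dual : ∀ {P X} → Pos P X → Neg (dual P) (X ⊥)
Pos⇒Neg-dual {P} (a , eq) = a , trans (fill-dual P (atom a)) (cong _⊥ eq)

Neg⊥⇒Pos-dual : ∀ {N X} → Neg N (X ⊥) → Pos (dual N) X
Neg⊥⇒Pos-dual {X = X} n with Neg⇒Pos-dual n
... | a , eq = a , trans eq (⊥-involutive X)

Pos⊥⇒Neg-dual : ∀ {P X} → Pos P (X ⊥) → Neg (dual P) X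
Pos⊥⇒Neg-dual {X = X} p with Pos⇒Neg-dual p
... | a , eq = a , trans eq (⊥-involutive X)

module _ {A B C D : Formula} where
  ⅋-injectiveˡ : A ⅋ B ≡ C ⅋ D → A ≡ C
  ⅋-injectiveˡ refl = refl
  ⅋-injectiveʳ : A ⅋ B ≡ C ⅋ D → B ≡ D
  ⅋-injectiveʳ refl = refl
  ⊗-injectiveˡ : A ⊗ B ≡ C ⊗ D → A ≡ C
  ⊗-injectiveˡ refl = refl
  ⊗-injectiveʳ : A ⊗ B ≡ C ⊗ D → B ≡ D
  ⊗-injectiveʳ refl = refl

⊡-injective : ∀ {A B} → ⊡ A ≡ ⊡ B → A ≡ B
⊡-injective refl = refl

◇-injective : ∀ {A B} → ◇ A ≡ ◇ B → A ≡ B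
◇-injective refl = refl

fill-injective : ∀ C {F G} → fill C F ≡ fill C G → F ≡ G
fill-injective hole     eq = eq
fill-injective (C ⅋ₗ _) eq = fill-injective C (⅋-injectiveˡ eq)
fill-injective (_ ⅋ᵣ C) eq = fill-injective C (⅋-injectiveʳ eq)
fill-injective (C ⊗ₗ _) eq = fill-injective C (⊗-injectiveˡ eq)
fill-injective (_ ⊗ᵣ C) eq = fill-injective C (⊗-injectiveʳ eq)
fill-injective (⊡c C)   eq = fill-injective C (⊡-injective eq)
fill-injective (◇c C)   eq = fill-injective C (◇-injective eq)

Neg-irrelevant : ∀ {C X} (n n′ : Neg C X) → n ≡ n′
Neg-irrelevant {C} (a , eq) (b , eq′)
  with fill-injective C (trans eq (sym eq′))
... | refl = cong (a ,_) (uip eq eq′)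

Pos-irrelevant : ∀ {C X} (p p′ : Pos C X) → p ≡ p′
Pos-irrelevant {C} (a , eq) (b , eq′)
  with fill-injective C (trans eq (sym eq′))
... | refl = cong (a ,_) (uip eq eq′)

fill-◇c^ : ∀ k C F → fill (◇c^ k C) F ≡ ◇^ k (fill C F)
fill-◇c^ zero    C F = refl
fill-◇c^ (suc k) C F = cong ◇ (fill-◇c^ k C F)

fill-⊡c^ : ∀ k C F → fill (⊡c^ k C) F ≡ ⊡^ k (fill C F)
fill-⊡c^ zero    C F = refl
fill-⊡c^ (suc k) C F = cong ⊡ (fill-⊡c^ k C F)

strip : ℕ → Ctx → Ctx
strip zero    C      = C
strip (suc k) (◇c C) = strip k C
strip (suc k) (⊡c C) = strip k C
strip (suc k) C      = C

strip-◇c^ : ∀ k C → strip k (◇c^ k C) ≡ C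
strip-◇c^ zero    C = refl
strip-◇c^ (suc k) C = strip-◇c^ k C

strip-⊡c^ : ∀ k C → strip k (⊡c^ k C) ≡ C
strip-⊡c^ zero    C = refl
strip-⊡c^ (suc k) C = strip-⊡c^ k C

size : Formula → ℕ
size (atom _)  = 1
size (natom _) = 1
size (A ⅋ B)   = size A + size B
size (A ⊗ B)   = size A + size B
size (⊡ A)     = size A
size (◇ A)     = size A

data NegView : Ctx → Formula → Set where
  hole : ∀ {a} → NegView hole (natom a)
  _⅋ₗ_ : ∀ {C A} → NegView C A → ∀ B → NegView (C ⅋ₗ B) (A ⅋ B)
  _⅋ᵣ_ : ∀ A {C B} → NegView C B → NegView (A ⅋ᵣ C) (A ⅋ B)
  _⊗ₗ_ : ∀ {C A} → NegView C A → ∀ B → NegView (C ⊗ₗ B) (A ⊗ B)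
  _⊗ᵣ_ : ∀ A {C B} → NegView C B → NegView (A ⊗ᵣ C) (A ⊗ B)
  ⊡c   : ∀ {C A} → NegView C A → NegView (⊡c C) (⊡ A)
  ◇c   : ∀ {C A} → NegView C A → NegView (◇c C) (◇ A)

negView : ∀ C {F} → Neg C F → NegView C F
negView hole     (a , refl) = hole
negView (C ⅋ₗ B) (a , refl) = negView C (a , refl) ⅋ₗ B
negView (A ⅋ᵣ C) (a , refl) = A ⅋ᵣ negView C (a , refl)
negView (C ⊗ₗ B) (a , refl) = negView C (a , refl) ⊗ₗ B
negView (A ⊗ᵣ C) (a , refl) = A ⊗ᵣ negView C (a , refl)
negView (⊡c C)   (a , refl) = ⊡c (negView C (a , refl))
negView (◇c C)   (a , refl) = ◇c (negView C (a , refl))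

viewNeg : ∀ {C F} → NegView C F → Neg C F
viewNeg (hole {a}) = a , refl
viewNeg (v ⅋ₗ B) with viewNeg v
... | a , eq = a , cong (_⅋ B) eq
viewNeg (A ⅋ᵣ v) with viewNeg v
... | a , eq = a , cong (A ⅋_) eq
viewNeg (v ⊗ₗ B) with viewNeg v
... | a , eq = a , cong (_⊗ B) eq
viewNeg (A ⊗ᵣ v) with viewNeg v
... | a , eq = a , cong (A ⊗_) eq
viewNeg (⊡c v) with viewNeg v
... | a , eq = a , cong ⊡ eq
viewNeg (◇c v) with viewNeg v
... | a , eq = a , cong ◇ eq

↑ˡ≢↑ʳ : ∀ {m n} (i : Fin m) (j : Fin n) → i ↑ˡ n ≢ m ↑ʳ j
↑ˡ≢↑ʳ {m} {n} i j eq
  with trans (sym (splitAt-↑ˡ m i n)) (trans (cong (splitAt m) eq) (splitAt-↑ʳ m n j))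
... | ()

-- the leaf of F at which the hole of a negative context sits; distinct
-- negative contexts sit at distinct leaves, so F has at most size F of them
hole-index : ∀ {C F} → NegView C F → Fin (size F)
hole-index hole     = Fin.zero
hole-index (v ⅋ₗ B) = hole-index v ↑ˡ size B
hole-index (A ⅋ᵣ v) = size A ↑ʳ hole-index v
hole-index (v ⊗ₗ B) = hole-index v ↑ˡ size B
hole-index (A ⊗ᵣ v) = size A ↑ʳ hole-index v
hole-index (⊡c v)   = hole-index v
hole-index (◇c v)   = hole-index v

hole-index-injective : ∀ {C C′ F} (v : NegView C F) (v′ : NegView C′ F) →
                       hole-index v ≡ hole-index v′ → C ≡ C′
hole-index-injective hole hole _ = refl
hole-index-injective (v ⅋ₗ _) (v′ ⅋ₗ _) eq =
  cong (_⅋ₗ _) (hole-index-injective v v′ (↑ˡ-injective _ _ _ eq))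
hole-index-injective (v ⅋ₗ _) (_ ⅋ᵣ v′) eq = ⊥-elim (↑ˡ≢↑ʳ _ _ eq)
hole-index-injective (_ ⅋ᵣ v) (v′ ⅋ₗ _) eq = ⊥-elim (↑ˡ≢↑ʳ _ _ (sym eq))
hole-index-injective (_ ⅋ᵣ v) (_ ⅋ᵣ v′) eq =
  cong (_ ⅋ᵣ_) (hole-index-injective v v′ (↑ʳ-injective _ _ _ eq))
hole-index-injective (v ⊗ₗ _) (v′ ⊗ₗ _) eq =
  cong (_⊗ₗ _) (hole-index-injective v v′ (↑ˡ-injective _ _ _ eq))
hole-index-injective (v ⊗ₗ _) (_ ⊗ᵣ v′) eq = ⊥-elim (↑ˡ≢↑ʳ _ _ eq)
hole-index-injective (_ ⊗ᵣ v) (v′ ⊗ₗ _) eq = ⊥-elim (↑ˡ≢↑ʳ _ _ (sym eq))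
hole-index-injective (_ ⊗ᵣ v) (_ ⊗ᵣ v′) eq =
  cong (_ ⊗ᵣ_) (hole-index-injective v v′ (↑ʳ-injective _ _ _ eq))
hole-index-injective (⊡c v) (⊡c v′) eq = cong ⊡c (hole-index-injective v v′ eq)
hole-index-injective (◇c v) (◇c v′) eq = cong ◇c (hole-index-injective v v′ eq)

data ◇View (A : Formula) (k : ℕ) : Ctx → Set where
  ◇[_] : ∀ {N} → Neg N A → ◇View A k (◇c^ k N)

◇view : ∀ k {A C} → NegView C (◇^ k A) → ◇View A k C
◇view zero    v = ◇[ viewNeg v ]
◇view (suc k) (◇c v) with ◇view k v
... | ◇[ n ] = ◇[ n ]

data ⊡View (A : Formula) (k : ℕ) : Ctx → Set where
  ⊡[_] : ∀ {N} → Neg N A → ⊡View A k (⊡c^ k N)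

⊡view : ∀ k {A C} → NegView C (⊡^ k A) → ⊡View A k C
⊡view zero    v = ⊡[ viewNeg v ]
⊡view (suc k) (⊡c v) with ⊡view k v
... | ⊡[ n ] = ⊡[ n ]

record Port (Γ : List Formula) : Set where
  constructor port
  field
    formula : Formula
    member  : formula ∈ Γ
    context : Ctx
open Port public

-- entries are the ports of initial states, exits those of final states
IsEntry : ∀ {Γ} → Port Γ → Set
IsEntry p = Neg (context p) (formula p)

IsExit : ∀ {Γ} → Port Γ → Set
IsExit p = Pos (context p) (formula p)

swap-involutive : ∀ Γ {A B Δ X} (k : X ∈ Γ ++ B ∷ A ∷ Δ) →
                  swap∈ Γ {A = A} {B = B} (swap∈ Γ k) ≡ k
swap-involutive []      (here _)          = refl
swap-involutive []      (there (here _))  = refl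
swap-involutive []      (there (there _)) = refl
swap-involutive (_ ∷ Γ) (here _)          = refl
swap-involutive (_ ∷ Γ) (there k)         = cong there (swap-involutive Γ k)

data Split (Γ Δ : List Formula) {X : Formula} : X ∈ Γ ++ Δ → Set where
  left  : (i : X ∈ Γ) → Split Γ Δ (++⁺ˡ i)
  right : (j : X ∈ Δ) → Split Γ Δ (++⁺ʳ Γ j)

split : ∀ Γ {Δ X} (k : X ∈ Γ ++ Δ) → Split Γ Δ k
split []      k         = right k
split (_ ∷ Γ) (here px) = left (here px)
split (_ ∷ Γ) (there k) with split Γ k
... | left i  = left (there i)
... | right j = right j

side-entry : ∀ {A B Γ Δ X k} → Split Γ Δ {X} k → (N : Ctx) → Neg N X →
             Σ (Port (A ∷ Γ)) IsEntry ⊎ Σ (Port (B ∷ Δ)) IsEntry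
side-entry (left i)  N e = inj₁ (port _ (there i) N , e)
side-entry (right j) N e = inj₂ (port _ (there j) N , e)

module _ (Γ : List Formula) {Δ : List Formula} where
  join : Port Γ ⊎ Port Δ → Port (Γ ++ Δ)
  join (inj₁ (port X i C)) = port X (++⁺ˡ i) C
  join (inj₂ (port X j C)) = port X (++⁺ʳ Γ j) C

  unjoin : Port (Γ ++ Δ) → Port Γ ⊎ Port Δ
  unjoin (port X k C) = Sum.map (λ i → port X i C) (λ j → port X j C) (++⁻ Γ k)

  unjoin-join : ∀ x → unjoin (join x) ≡ x
  unjoin-join (inj₁ (port X i C)) rewrite ++⁻∘++⁺ Γ {Δ} (inj₁ i) = refl
  unjoin-join (inj₂ (port X j C)) rewrite ++⁻∘++⁺ Γ {Δ} (inj₂ j) = refl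

  join-injective : ∀ x y → join x ≡ join y → x ≡ y
  join-injective x y eq = trans (sym (unjoin-join x)) (trans (cong unjoin eq) (unjoin-join y))

module Execution (QS : QStruct) where
  open QStruct QS
  open QMLL QS

  RegAt : ∀ {Γ} → Port Γ → Stack → Set
  RegAt p s = Reg (depth (context p) + length s)

  at : ∀ {Γ} {π : Proof Γ} (p : Port Γ) (s : Stack) → RegAt p s → State π
  at p s Q = st (formula p) (concl (member p)) (context p) s Q

  _⇝_ : ∀ {Γ} {π : Proof Γ} {R : Set} → State π → (R → State π) → Set
  _⇝_ {π = π} {R} S target = Σ R λ Q → Star (Step π) S (target Q)

  _⨾_ : ∀ {Γ} {π : Proof Γ} {R R′ : Set} {S : State π} {F : R → State π} {G : R′ → State π} →
        S ⇝ F → (∀ Q → F Q ⇝ G) → S ⇝ G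
  (Q , r) ⨾ continue with continue Q
  ... | Q′ , r′ = Q′ , r ◅◅ r′

  lift⇝ : ∀ {Γ Δ} {ρ : Proof Δ} {π : Proof Γ} {R : Set} {S : State ρ} {F : R → State ρ}
          {f : ∀ {X} → Occ ρ X → Occ π X} →
          (∀ {S T} → Step ρ S T → Step π (mapState f S) (mapState f T)) →
          S ⇝ F → mapState f S ⇝ (mapState f ∘ F)
  lift⇝ g (Q , r) = Q , gmap (mapState _) g r

  record Behaviour {Γ} (π : Proof Γ) : Set where
    field
      exit           : (p : Port Γ) → IsEntry p → Port Γ
      exit-isExit    : ∀ p e → IsExit (exit p e)
      exit-injective : ∀ {p p′} e e′ → exit p e ≡ exit p′ e′ → p ≡ p′
      run            : ∀ p e s Q → at {π = π} p s Q ⇝ at (exit p e) s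

  axiom : ∀ A → Behaviour (ax A)
  axiom A = record { exit = exit ; exit-isExit = exit-isExit
                   ; exit-injective = exit-injective ; run = run }
    where
      exit : (p : Port (A ⊥ ∷ A ∷ [])) → IsEntry p → Port (A ⊥ ∷ A ∷ [])
      exit (port _ (here refl) N)         _ = port A (there (here refl)) (dual N)
      exit (port _ (there (here refl)) N) _ = port (A ⊥) (here refl) (dual N)

      exit-isExit : ∀ p e → IsExit (exit p e)
      exit-isExit (port _ (here refl) _)         e = Neg⊥⇒Pos-dual e
      exit-isExit (port _ (there (here refl)) _) e = Neg⇒Pos-dual e

      exit-injective : ∀ {p p′} e e′ → exit p e ≡ exit p′ e′ → p ≡ p′
      exit-injective {port _ (here refl) _} {port _ (here refl) _} _ _ eq =
        cong (port _ _) (dual-injective (cong context eq))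
      exit-injective {port _ (there (here refl)) _} {port _ (there (here refl)) _} _ _ eq =
        cong (port _ _) (dual-injective (cong context eq))
      exit-injective {port _ (here refl) _} {port _ (there (here refl)) _} _ _ eq
        with cong (index ∘ member) eq
      ... | ()
      exit-injective {port _ (there (here refl)) _} {port _ (here refl) _} _ _ eq
        with cong (index ∘ member) eq
      ... | ()

      run : ∀ p e s Q → at {π = ax A} p s Q ⇝ at (exit p e) s
      run (port _ (here refl) _)         e s Q = _ , axA⊥ e ◅ ε
      run (port _ (there (here refl)) _) e s Q = _ , axA e ◅ ε

  -- A rule with one premise ρ whose execution passes an entry of π to an entry
  -- of ρ (pushing onto the stack), and an exit of ρ back to an exit of π,
  -- both injectively (witnessed by left inverses) and by explicit steps.
  record Relay {Γ Δ} (π : Proof Γ) (ρ : Proof Δ) : Set where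
    field
      lift          : ∀ {X} → Occ ρ X → Occ π X
      lift-step     : ∀ {S T} → Step ρ S T → Step π (mapState lift S) (mapState lift T)
      push          : Port Γ → Stack → Stack
      enter         : (p : Port Γ) → IsEntry p → Σ (Port Δ) IsEntry
      unenter       : Port Δ → Port Γ
      unenter-enter : ∀ p e → unenter (proj₁ (enter p e)) ≡ p
      leave         : Port Δ → Port Γ
      unleave       : Port Γ → Port Δ
      unleave-leave : ∀ q → unleave (leave q) ≡ q
      leave-isExit  : ∀ q → IsExit q → IsExit (leave q)
      enter-run     : ∀ p e s Q →
                      at p s Q ⇝ (mapState lift ∘ at (proj₁ (enter p e)) (push p s))
      leave-run     : ∀ p q → IsExit q → ∀ s Q →
                      mapState lift (at q (push p s) Q) ⇝ at (leave q) s

  relay : ∀ {Γ Δ} {π : Proof Γ} {ρ : Proof Δ} → Relay π ρ → Behaviour ρ → Behaviour π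
  relay {Γ} {Δ} {π} R B = record
    { exit           = λ p e → leave (inner p e)
    ; exit-isExit    = λ p e → leave-isExit (inner p e) (B.exit-isExit _ _)
    ; exit-injective = exit-injective
    ; run            = run
    }
    where
      open Relay R
      module B = Behaviour B

      inner : (p : Port Γ) → IsEntry p → Port Δ
      inner p e = B.exit (proj₁ (enter p e)) (proj₂ (enter p e))

      exit-injective : ∀ {p p′} e e′ → leave (inner p e) ≡ leave (inner p′ e′) → p ≡ p′
      exit-injective {p} {p′} e e′ eq = begin
        p                             ≡⟨ sym (unenter-enter p e) ⟩
        unenter (proj₁ (enter p e))   ≡⟨ cong unenter (B.exit-injective _ _ inner-eq) ⟩
        unenter (proj₁ (enter p′ e′)) ≡⟨ unenter-enter p′ e′ ⟩
        p′                            ∎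
        where
          open ≡-Reasoning
          inner-eq : inner p e ≡ inner p′ e′
          inner-eq = trans (sym (unleave-leave _)) (trans (cong unleave eq) (unleave-leave _))

      run : ∀ p e s Q → at {π = π} p s Q ⇝ at (leave (inner p e)) s
      run p e s Q =
        enter-run p e s Q ⨾ λ Q₁ →
        lift⇝ lift-step (B.run (proj₁ (enter p e)) (proj₂ (enter p e)) (push p s) Q₁) ⨾ λ Q₂ →
        leave-run p (inner p e) (B.exit-isExit _ _) s Q₂

  par-relay : ∀ {A B Γ} (ρ : Proof (A ∷ B ∷ Γ)) → Relay (par ρ) ρ
  par-relay {A} {B} {Γ} ρ = record
    { lift = par↑ ; lift-step = in-par ; push = λ _ s → s
    ; enter = enter ; unenter = unenter ; unenter-enter = unenter-enter
    ; leave = leave ; unleave = unleave ; unleave-leave = unleave-leave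
    ; leave-isExit = leave-isExit ; enter-run = enter-run ; leave-run = leave-run
    }
    where
      enter-⅋ : ∀ {N} → NegView N (A ⅋ B) → Σ (Port (A ∷ B ∷ Γ)) IsEntry
      enter-⅋ (_⅋ₗ_ {C = N} v _) = port A (here refl) N , viewNeg v
      enter-⅋ (_⅋ᵣ_ _ {C = N} v) = port B (there (here refl)) N , viewNeg v

      enter : (p : Port (A ⅋ B ∷ Γ)) → IsEntry p → Σ (Port (A ∷ B ∷ Γ)) IsEntry
      enter (port _ (here refl) N) e = enter-⅋ (negView N e)
      enter (port X (there i) N)   e = port X (there (there i)) N , e

      unenter : Port (A ∷ B ∷ Γ) → Port (A ⅋ B ∷ Γ)
      unenter (port _ (here _) N)           = port (A ⅋ B) (here refl) (N ⅋ₗ B)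
      unenter (port _ (there (here _)) N)   = port (A ⅋ B) (here refl) (A ⅋ᵣ N)
      unenter (port X (there (there i)) N)  = port X (there i) N

      unenter-enter-⅋ : ∀ {N} (v : NegView N (A ⅋ B)) →
                        unenter (proj₁ (enter-⅋ v)) ≡ port (A ⅋ B) (here refl) N
      unenter-enter-⅋ (v ⅋ₗ _) = refl
      unenter-enter-⅋ (_ ⅋ᵣ v) = refl

      unenter-enter : ∀ p e → unenter (proj₁ (enter p e)) ≡ p
      unenter-enter (port _ (here refl) N) e = unenter-enter-⅋ (negView N e)
      unenter-enter (port X (there i) N)   e = refl

      leave : Port (A ∷ B ∷ Γ) → Port (A ⅋ B ∷ Γ)
      leave (port _ (here refl) P)         = port (A ⅋ B) (here refl) (P ⅋ₗ B)
      leave (port _ (there (here refl)) P) = port (A ⅋ B) (here refl) (A ⅋ᵣ P)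
      leave (port X (there (there i)) P)   = port X (there i) P

      -- the last clause for the principal port is junk: no exit of the premise leads there
      unleave : Port (A ⅋ B ∷ Γ) → Port (A ∷ B ∷ Γ)
      unleave (port _ (here _) (P ⅋ₗ _)) = port A (here refl) P
      unleave (port _ (here _) (_ ⅋ᵣ P)) = port B (there (here refl)) P
      unleave (port X (there i) P)       = port X (there (there i)) P
      unleave (port _ (here _) _)        = port A (here refl) hole

      unleave-leave : ∀ q → unleave (leave q) ≡ q
      unleave-leave (port _ (here refl) P)         = refl
      unleave-leave (port _ (there (here refl)) P) = refl
      unleave-leave (port X (there (there i)) P)   = refl

      leave-isExit : ∀ q → IsExit q → IsExit (leave q)
      leave-isExit (port _ (here refl) P)         (a , eq) = a , cong (_⅋ B) eq
      leave-isExit (port _ (there (here refl)) P) (a , eq) = a , cong (A ⅋_) eq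
      leave-isExit (port X (there (there i)) P)   x        = x

      enter-run-⅋ : ∀ {N} (v : NegView N (A ⅋ B)) s Q →
                    st (A ⅋ B) (concl (here refl)) N s Q
                      ⇝ (mapState par↑ ∘ at {π = ρ} (proj₁ (enter-⅋ v)) s)
      enter-run-⅋ (v ⅋ₗ _) s Q = Q , par↓ₗ (viewNeg v) ◅ ε
      enter-run-⅋ (_ ⅋ᵣ v) s Q = Q , par↓ᵣ (viewNeg v) ◅ ε

      enter-run : ∀ p e s Q →
                  at {π = par ρ} p s Q ⇝ (mapState par↑ ∘ at (proj₁ (enter p e)) s)
      enter-run (port _ (here refl) N) e s Q = enter-run-⅋ (negView N e) s Q
      enter-run (port X (there i) N)   e s Q = Q , pass↓ (parΓ i) e ◅ ε

      leave-run : ∀ (p : Port (A ⅋ B ∷ Γ)) q → IsExit q → ∀ s Q →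
                  mapState par↑ (at {π = ρ} q s Q) ⇝ at (leave q) s
      leave-run _ (port _ (here refl) P)         x s Q = Q , par↑ₗ x ◅ ε
      leave-run _ (port _ (there (here refl)) P) x s Q = Q , par↑ᵣ x ◅ ε
      leave-run _ (port X (there (there i)) P)   x s Q = Q , pass↑ (parΓ i) x ◅ ε

  ex-relay : ∀ Γ {A B Δ} (ρ : Proof (Γ ++ A ∷ B ∷ Δ)) → Relay (ex Γ ρ) ρ
  ex-relay Γ {A} {B} {Δ} ρ = record
    { lift = ex↑ ; lift-step = in-ex ; push = λ _ s → s
    ; enter = λ p e → swap p , e ; unenter = swap ; unenter-enter = λ p _ → swap-swap p
    ; leave = swap ; unleave = swap ; unleave-leave = swap-swap
    ; leave-isExit = λ _ x → x ; enter-run = enter-run ; leave-run = leave-run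
    }
    where
      swap : ∀ {A B} → Port (Γ ++ A ∷ B ∷ Δ) → Port (Γ ++ B ∷ A ∷ Δ)
      swap (port X k C) = port X (swap∈ Γ k) C

      swap-swap : ∀ {A B} (p : Port (Γ ++ B ∷ A ∷ Δ)) → swap {A} {B} (swap p) ≡ p
      swap-swap (port X k C) = cong (λ k′ → port X k′ C) (swap-involutive Γ k)

      enter-run : ∀ p e s Q → at {π = ex Γ ρ} p s Q ⇝ (mapState ex↑ ∘ at (swap p) s)
      enter-run (port X k N) e s Q =
        Q , subst (λ k′ → Step (ex Γ ρ) (st X (concl k′) N s Q)
                                        (st X (ex↑ (concl (swap∈ Γ k))) N s Q))
                  (swap-involutive Γ k) (pass↓ (exC (swap∈ Γ k)) e) ◅ ε

      leave-run : ∀ (p : Port (Γ ++ B ∷ A ∷ Δ)) q → IsExit q → ∀ s Q →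
                  mapState ex↑ (at {π = ρ} q s Q) ⇝ at (swap q) s
      leave-run _ (port X k P) x s Q = Q , pass↑ (exC k) x ◅ ε

  -- quantum rule: entries strip the k modalities and push k copies of the
  -- entered modality on the stack; exits pop them (applying U or U* when the
  -- modalities differ)
  qr-relay : ∀ {A B} n (U : Unitary (suc n)) (m : isModal A ≡ isModal B)
             (ρ : Proof (A ∷ B ∷ [])) → Relay (qr n U m ρ) ρ
  qr-relay {A} {B} n U m ρ = record
    { lift = qr↑ ; lift-step = in-qr ; push = λ p s → s ++ replicate k (mark p)
    ; enter = enter ; unenter = unenter ; unenter-enter = unenter-enter
    ; leave = leave ; unleave = unleave ; unleave-leave = unleave-leave
    ; leave-isExit = leave-isExit ; enter-run = enter-run ; leave-run = leave-run
    }
    where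
      k : ℕ
      k = suc n

      π : Proof (◇^ k A ∷ ⊡^ k B ∷ [])
      π = qr n U m ρ

      mark : Port (◇^ k A ∷ ⊡^ k B ∷ []) → Mod
      mark (port _ (here _) _)  = m◇
      mark (port _ (there _) _) = m⊡

      enter-◇ : ∀ {N} → ◇View A k N → Σ (Port (A ∷ B ∷ [])) IsEntry
      enter-◇ (◇[_] {N} e) = port A (here refl) N , e

      enter-⊡ : ∀ {N} → ⊡View B k N → Σ (Port (A ∷ B ∷ [])) IsEntry
      enter-⊡ (⊡[_] {N} e) = port B (there (here refl)) N , e

      enter : (p : Port (◇^ k A ∷ ⊡^ k B ∷ [])) → IsEntry p → Σ (Port (A ∷ B ∷ [])) IsEntry
      enter (port _ (here refl) N)         e = enter-◇ (◇view k (negView N e))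
      enter (port _ (there (here refl)) N) e = enter-⊡ (⊡view k (negView N e))

      unenter : Port (A ∷ B ∷ []) → Port (◇^ k A ∷ ⊡^ k B ∷ [])
      unenter (port _ (here _) N)  = port (◇^ k A) (here refl) (◇c^ k N)
      unenter (port _ (there _) N) = port (⊡^ k B) (there (here refl)) (⊡c^ k N)

      unenter-enter : ∀ p e → unenter (proj₁ (enter p e)) ≡ p
      unenter-enter (port _ (here refl) N) e with ◇view k (negView N e)
      ... | ◇[ _ ] = refl
      unenter-enter (port _ (there (here refl)) N) e with ⊡view k (negView N e)
      ... | ⊡[ _ ] = refl

      leave : Port (A ∷ B ∷ []) → Port (◇^ k A ∷ ⊡^ k B ∷ [])
      leave (port _ (here refl) P)         = port (◇^ k A) (here refl) (◇c^ k P)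
      leave (port _ (there (here refl)) P) = port (⊡^ k B) (there (here refl)) (⊡c^ k P)

      unleave : Port (◇^ k A ∷ ⊡^ k B ∷ []) → Port (A ∷ B ∷ [])
      unleave (port _ (here _) P)  = port A (here refl) (strip k P)
      unleave (port _ (there _) P) = port B (there (here refl)) (strip k P)

      unleave-leave : ∀ q → unleave (leave q) ≡ q
      unleave-leave (port _ (here refl) P)         = cong (port A (here refl)) (strip-◇c^ k P)
      unleave-leave (port _ (there (here refl)) P) = cong (port B (there (here refl))) (strip-⊡c^ k P)

      leave-isExit : ∀ q → IsExit q → IsExit (leave q)
      leave-isExit (port _ (here refl) P) (a , eq) =
        a , trans (fill-◇c^ k P (atom a)) (cong (◇^ k) eq)
      leave-isExit (port _ (there (here refl)) P) (a , eq) =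
        a , trans (fill-⊡c^ k P (atom a)) (cong (⊡^ k) eq)

      enter-run : ∀ p e s Q →
                  at {π = π} p s Q ⇝ (mapState qr↑ ∘ at (proj₁ (enter p e)) (s ++ replicate k (mark p)))
      enter-run (port _ (here refl) N) e s Q with ◇view k (negView N e)
      ... | ◇[ e′ ] = _ , q↓◇ e′ ◅ ε
      enter-run (port _ (there (here refl)) N) e s Q with ⊡view k (negView N e)
      ... | ⊡[ e′ ] = _ , q↓⊡ e′ ◅ ε

      leave-run : ∀ p q → IsExit q → ∀ s Q →
                  mapState qr↑ (at {π = ρ} q (s ++ replicate k (mark p)) Q) ⇝ at (leave q) s
      leave-run (port _ (here _) _)  (port _ (here refl) _)         x s Q = _ , q↑◇◇ x ◅ ε
      leave-run (port _ (here _) _)  (port _ (there (here refl)) _) x s Q = _ , q↑⊡◇ x ◅ ε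
      leave-run (port _ (there _) _) (port _ (here refl) _)         x s Q = _ , q↑◇⊡ x ◅ ε
      leave-run (port _ (there _) _) (port _ (there (here refl)) _) x s Q = _ , q↑⊡⊡ x ◅ ε

  module Juxtaposition {Γc Γ Δ} {π : Proof Γc} {ρ : Proof Γ} {σ : Proof Δ}
    (lift₁ : ∀ {X} → Occ ρ X → Occ π X)
    (lift₁-step : ∀ {S T} → Step ρ S T → Step π (mapState lift₁ S) (mapState lift₁ T))
    (lift₂ : ∀ {X} → Occ σ X → Occ π X)
    (lift₂-step : ∀ {S T} → Step σ S T → Step π (mapState lift₂ S) (mapState lift₂ T))
    (Bρ : Behaviour ρ) (Bσ : Behaviour σ) where
    private
      module Bρ = Behaviour Bρ
      module Bσ = Behaviour Bσ

    Side : Set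
    Side = Port Γ ⊎ Port Δ

    Token : Set
    Token = Σ (Port Γ) IsEntry ⊎ Σ (Port Δ) IsEntry

    Exit : Set
    Exit = Σ (Port Γ) IsExit ⊎ Σ (Port Δ) IsExit

    port-of-token : Token → Side
    port-of-token = Sum.map proj₁ proj₁

    port-of-exit : Exit → Side
    port-of-exit = Sum.map proj₁ proj₁

    inner : Token → Exit
    inner (inj₁ (p , e)) = inj₁ (Bρ.exit p e , Bρ.exit-isExit p e)
    inner (inj₂ (p , e)) = inj₂ (Bσ.exit p e , Bσ.exit-isExit p e)

    inner-injective : ∀ t t′ → port-of-exit (inner t) ≡ port-of-exit (inner t′) → t ≡ t′
    inner-injective (inj₁ (p , e)) (inj₁ (p′ , e′)) eq
      with Bρ.exit-injective e e′ (inj₁-injective eq)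
    ... | refl = cong (λ e → inj₁ (p , e)) (Neg-irrelevant e e′)
    inner-injective (inj₂ (p , e)) (inj₂ (p′ , e′)) eq
      with Bσ.exit-injective e e′ (inj₂-injective eq)
    ... | refl = cong (λ e → inj₂ (p , e)) (Neg-irrelevant e e′)
    inner-injective (inj₁ _) (inj₂ _) ()
    inner-injective (inj₂ _) (inj₁ _) ()

    RegOn : Side → Stack → Set
    RegOn (inj₁ p) s = RegAt p s
    RegOn (inj₂ q) s = RegAt q s

    on : (x : Side) (s : Stack) → RegOn x s → State π
    on (inj₁ p) s Q = mapState lift₁ (at p s Q)
    on (inj₂ q) s Q = mapState lift₂ (at q s Q)

    inner-run : ∀ t s Q → on (port-of-token t) s Q ⇝ on (port-of-exit (inner t)) s
    inner-run (inj₁ (p , e)) s Q = lift⇝ lift₁-step (Bρ.run p e s Q)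
    inner-run (inj₂ (q , e)) s Q = lift⇝ lift₂-step (Bσ.run q e s Q)

  tensor : ∀ {A B Γ Δ} {ρ : Proof (A ∷ Γ)} {σ : Proof (B ∷ Δ)} →
           Behaviour ρ → Behaviour σ → Behaviour (ten ρ σ)
  tensor {A} {B} {Γ} {Δ} {ρ} {σ} Bρ Bσ = record
    { exit           = λ p e → leave (port-of-exit (inner (enter p e)))
    ; exit-isExit    = λ p e → leave-isExit (inner (enter p e))
    ; exit-injective = exit-injective
    ; run            = run
    }
    where
      open Juxtaposition ten₁ in-ten₁ ten₂ in-ten₂ Bρ Bσ
      Γc : List Formula
      Γc = A ⊗ B ∷ Γ ++ Δ

      shift : ∀ {C Θ} → Port Θ → Port (C ∷ Θ)
      shift (port X i P) = port X (there i) P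

      enter-⊗ : ∀ {N} → NegView N (A ⊗ B) → Token
      enter-⊗ (_⊗ₗ_ {C = N} v _) = inj₁ (port A (here refl) N , viewNeg v)
      enter-⊗ (_⊗ᵣ_ _ {C = N} v) = inj₂ (port B (here refl) N , viewNeg v)

      enter : (p : Port Γc) → IsEntry p → Token
      enter (port _ (here refl) N) e = enter-⊗ (negView N e)
      enter (port X (there k) N)   e = side-entry (split Γ k) N e

      unenter : Side → Port Γc
      unenter (inj₁ (port _ (here _) N))  = port (A ⊗ B) (here refl) (N ⊗ₗ B)
      unenter (inj₁ (port X (there i) N)) = port X (there (++⁺ˡ i)) N
      unenter (inj₂ (port _ (here _) N))  = port (A ⊗ B) (here refl) (A ⊗ᵣ N)
      unenter (inj₂ (port X (there j) N)) = port X (there (++⁺ʳ Γ j)) N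

      unenter-enter : ∀ p e → unenter (port-of-token (enter p e)) ≡ p
      unenter-enter (port _ (here refl) N) e with negView N e
      ... | _ ⊗ₗ _ = refl
      ... | _ ⊗ᵣ _ = refl
      unenter-enter (port X (there k) N) e with split Γ k
      ... | left _  = refl
      ... | right _ = refl

      leave : Side → Port Γc
      leave (inj₁ (port _ (here _) P))  = port (A ⊗ B) (here refl) (P ⊗ₗ B)
      leave (inj₂ (port _ (here _) P))  = port (A ⊗ B) (here refl) (A ⊗ᵣ P)
      leave (inj₁ (port X (there i) P)) = shift (join Γ (inj₁ (port X i P)))
      leave (inj₂ (port X (there j) P)) = shift (join Γ (inj₂ (port X j P)))

      -- the last clause for the principal port is junk: no exit of a premise leads there
      unleave : Port Γc → Side
      unleave (port _ (here _) (P ⊗ₗ _)) = inj₁ (port A (here refl) P)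
      unleave (port _ (here _) (_ ⊗ᵣ P)) = inj₂ (port B (here refl) P)
      unleave (port X (there k) P)       = Sum.map shift shift (unjoin Γ (port X k P))
      unleave (port _ (here _) _)        = inj₁ (port A (here refl) hole)

      unleave-leave : ∀ x → unleave (leave x) ≡ x
      unleave-leave (inj₁ (port _ (here refl) P))  = refl
      unleave-leave (inj₂ (port _ (here refl) P))  = refl
      unleave-leave (inj₁ (port X (there i) P)) =
        cong (Sum.map shift shift) (unjoin-join Γ (inj₁ (port X i P)))
      unleave-leave (inj₂ (port X (there j) P)) =
        cong (Sum.map shift shift) (unjoin-join Γ (inj₂ (port X j P)))

      leave-isExit : ∀ x → IsExit (leave (port-of-exit x))
      leave-isExit (inj₁ (port _ (here refl) P , (a , eq))) = a , cong (_⊗ B) eq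
      leave-isExit (inj₂ (port _ (here refl) P , (a , eq))) = a , cong (A ⊗_) eq
      leave-isExit (inj₁ (port X (there i) P , x)) = x
      leave-isExit (inj₂ (port X (there j) P , x)) = x

      exit-injective : ∀ {p p′} e e′ → leave (port-of-exit (inner (enter p e)))
                                     ≡ leave (port-of-exit (inner (enter p′ e′))) → p ≡ p′
      exit-injective {p} {p′} e e′ eq = begin
        p                                   ≡⟨ sym (unenter-enter p e) ⟩
        unenter (port-of-token (enter p e))   ≡⟨ cong (unenter ∘ port-of-token) same-token ⟩
        unenter (port-of-token (enter p′ e′)) ≡⟨ unenter-enter p′ e′ ⟩
        p′                                  ∎
        where
          open ≡-Reasoning
          same-token : enter p e ≡ enter p′ e′
          same-token = inner-injective _ _
            (trans (sym (unleave-leave _)) (trans (cong unleave eq) (unleave-leave _)))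

      enter-run-⊗ : ∀ {N} (v : NegView N (A ⊗ B)) s Q →
                    st (A ⊗ B) (concl (here refl)) N s Q ⇝ on (port-of-token (enter-⊗ v)) s
      enter-run-⊗ (v ⊗ₗ _) s Q = Q , ten↓ₗ (viewNeg v) ◅ ε
      enter-run-⊗ (_ ⊗ᵣ v) s Q = Q , ten↓ᵣ (viewNeg v) ◅ ε

      enter-run-side : ∀ {X k} (v : Split Γ Δ {X} k) N e s Q →
                       st X (concl (there k)) N s Q ⇝ on (port-of-token (side-entry v N e)) s
      enter-run-side (left i)  N e s Q = Q , pass↓ (tenΓ i) e ◅ ε
      enter-run-side (right j) N e s Q = Q , pass↓ (tenΔ j) e ◅ ε

      enter-run : ∀ p e s Q → at {π = ten ρ σ} p s Q ⇝ on (port-of-token (enter p e)) s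
      enter-run (port _ (here refl) N) e s Q = enter-run-⊗ (negView N e) s Q
      enter-run (port X (there k) N)   e s Q = enter-run-side (split Γ k) N e s Q

      leave-run : ∀ x s Q → on (port-of-exit x) s Q ⇝ at (leave (port-of-exit x)) s
      leave-run (inj₁ (port _ (here refl) P , x)) s Q = Q , ten↑ₗ x ◅ ε
      leave-run (inj₂ (port _ (here refl) P , x)) s Q = Q , ten↑ᵣ x ◅ ε
      leave-run (inj₁ (port X (there i) P , x))   s Q = Q , pass↑ (tenΓ i) x ◅ ε
      leave-run (inj₂ (port X (there j) P , x))   s Q = Q , pass↑ (tenΔ j) x ◅ ε

      run : ∀ p e s Q → at {π = ten ρ σ} p s Q ⇝ at (leave (port-of-exit (inner (enter p e)))) s
      run p e s Q =
        enter-run p e s Q ⨾ λ Q₁ →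
        inner-run (enter p e) s Q₁ ⨾ λ Q₂ →
        leave-run (inner (enter p e)) s Q₂

  -- cut: an exit of a premise through the cut formula re-enters the other
  -- premise at the dual context; the run of an entry is the orbit of `next`
  module Cut {A Γ Δ} (ρ : Proof (A ∷ Γ)) (σ : Proof (A ⊥ ∷ Δ))
             (Bρ : Behaviour ρ) (Bσ : Behaviour σ) where
    open Juxtaposition cut₁ in-cut₁ cut₂ in-cut₂ Bρ Bσ

    Output : Set
    Output = Σ (Port Γ) IsExit ⊎ Σ (Port Δ) IsExit

    port-of-output : Output → Port Γ ⊎ Port Δ
    port-of-output = Sum.map proj₁ proj₁

    output : Output → Port (Γ ++ Δ)
    output o = join Γ (port-of-output o)

    output-isExit : ∀ o → IsExit (output o)
    output-isExit (inj₁ (_ , x)) = x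
    output-isExit (inj₂ (_ , x)) = x

    output-injective : ∀ o o′ → output o ≡ output o′ → o ≡ o′
    output-injective (inj₁ (q , x)) (inj₁ (q′ , x′)) eq
      with join-injective Γ (inj₁ q) (inj₁ q′) eq
    ... | refl = cong (λ x → inj₁ (q , x)) (Pos-irrelevant x x′)
    output-injective (inj₂ (q , x)) (inj₂ (q′ , x′)) eq
      with join-injective Γ (inj₂ q) (inj₂ q′) eq
    ... | refl = cong (λ x → inj₂ (q , x)) (Pos-irrelevant x x′)
    output-injective (inj₁ (q , _)) (inj₂ (q′ , _)) eq
      with join-injective Γ (inj₁ q) (inj₂ q′) eq
    ... | ()
    output-injective (inj₂ (q , _)) (inj₁ (q′ , _)) eq
      with join-injective Γ (inj₂ q) (inj₁ q′) eq
    ... | ()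

    cross : Exit → Token ⊎ Output
    cross (inj₁ (port _ (here refl) P , x)) =
      inj₁ (inj₂ (port (A ⊥) (here refl) (dual P) , Pos⇒Neg-dual x))
    cross (inj₂ (port _ (here refl) P , x)) =
      inj₁ (inj₁ (port A (here refl) (dual P) , Pos⊥⇒Neg-dual x))
    cross (inj₁ (port Y (there i) P , x)) = inj₂ (inj₁ (port Y i P , x))
    cross (inj₂ (port Y (there j) P , x)) = inj₂ (inj₂ (port Y j P , x))

    uncross : Token ⊎ Output → Side
    uncross (inj₁ (inj₁ (p , _)))            = inj₂ (port (A ⊥) (here refl) (dual (context p)))
    uncross (inj₁ (inj₂ (p , _)))            = inj₁ (port A (here refl) (dual (context p)))
    uncross (inj₂ (inj₁ (port Y i P , _)))   = inj₁ (port Y (there i) P)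
    uncross (inj₂ (inj₂ (port Y j P , _)))   = inj₂ (port Y (there j) P)

    uncross-cross : ∀ x → uncross (cross x) ≡ port-of-exit x
    uncross-cross (inj₁ (port _ (here refl) P , _)) =
      cong (inj₁ ∘ port A (here refl)) (dual-involutive P)
    uncross-cross (inj₂ (port _ (here refl) P , _)) =
      cong (inj₂ ∘ port (A ⊥) (here refl)) (dual-involutive P)
    uncross-cross (inj₁ (port Y (there i) P , _)) = refl
    uncross-cross (inj₂ (port Y (there j) P , _)) = refl

    next : Token → Token ⊎ Output
    next t = cross (inner t)

    next-injective : ∀ {t t′} → next t ≡ next t′ → t ≡ t′
    next-injective {t} {t′} eq = inner-injective t t′
      (trans (sym (uncross-cross (inner t))) (trans (cong uncross eq) (uncross-cross (inner t′))))

    data AtCut : Token → Set where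
      left  : ∀ N e → AtCut (inj₁ (port A (here refl) N , e))
      right : ∀ N e → AtCut (inj₂ (port (A ⊥) (here refl) N , e))

    crossed-at-cut : ∀ x {t} → cross x ≡ inj₁ t → AtCut t
    crossed-at-cut (inj₁ (port _ (here refl) P , _)) refl = right _ _
    crossed-at-cut (inj₂ (port _ (here refl) P , _)) refl = left _ _
    crossed-at-cut (inj₁ (port _ (there _) _ , _)) ()
    crossed-at-cut (inj₂ (port _ (there _) _ , _)) ()

    -- tokens at the cut formula are coded by the leaf of A or A⊥ holding the
    -- hole; the code zero is left for the other tokens
    code : Token → Fin (suc (size A + size (A ⊥)))
    code (inj₁ (port _ (here refl) N , e)) = Fin.suc (hole-index (negView N e) ↑ˡ size (A ⊥))
    code (inj₂ (port _ (here refl) N , e)) = Fin.suc (size A ↑ʳ hole-index (negView N e))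
    code _                                  = Fin.zero

    code-injective-at-cut : ∀ {t t′} → AtCut t → AtCut t′ → code t ≡ code t′ → t ≡ t′
    code-injective-at-cut (left N e) (left N′ e′) eq
      with hole-index-injective (negView N e) (negView N′ e′) (↑ˡ-injective _ _ _ (suc-injective eq))
    ... | refl = cong (λ e → inj₁ (_ , e)) (Neg-irrelevant e e′)
    code-injective-at-cut (right N e) (right N′ e′) eq
      with hole-index-injective (negView N e) (negView N′ e′) (↑ʳ-injective _ _ _ (suc-injective eq))
    ... | refl = cong (λ e → inj₂ (_ , e)) (Neg-irrelevant e e′)
    code-injective-at-cut (left _ _) (right _ _) eq = ⊥-elim (↑ˡ≢↑ʳ _ _ (suc-injective eq))
    code-injective-at-cut (right _ _) (left _ _) eq = ⊥-elim (↑ˡ≢↑ʳ _ _ (sym (suc-injective eq)))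

    code-injective : ∀ {u u′ t t′} → next u ≡ inj₁ t → next u′ ≡ inj₁ t′ →
                     code t ≡ code t′ → t ≡ t′
    code-injective {u} {u′} eq eq′ =
      code-injective-at-cut (crossed-at-cut (inner u) eq) (crossed-at-cut (inner u′) eq′)

    open Orbits next next-injective code code-injective

    -- an entry of the cut enters the premise containing its formula; these
    -- tokens are not at the cut formula, hence sources of the orbit
    start : (p : Port (Γ ++ Δ)) → IsEntry p → Token
    start (port X k N) e = side-entry (split Γ k) N e

    start-source : ∀ p e → Source (start p e)
    start-source (port X k N) e {u} eq with split Γ k | crossed-at-cut (inner u) eq
    ... | left _  | ()
    ... | right _ | ()

    start-injective : ∀ {p p′} e e′ → start p e ≡ start p′ e′ → p ≡ p′
    start-injective {port X k N} {port X′ k′ N′} e e′ eq with split Γ k | split Γ k′ | eq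
    ... | left _  | left _  | refl = refl
    ... | right _ | right _ | refl = refl

    Next : Token ⊎ Output → Stack → Set
    Next (inj₁ t) s = RegOn (port-of-token t) s
    Next (inj₂ o) s = RegAt (output o) s

    at-next : (r : Token ⊎ Output) (s : Stack) → Next r s → State (cut ρ σ)
    at-next (inj₁ t) s Q = on (port-of-token t) s Q
    at-next (inj₂ o) s Q = at (output o) s Q

    cross-run : ∀ x s Q → on (port-of-exit x) s Q ⇝ at-next (cross x) s
    cross-run (inj₁ (port _ (here refl) P , x)) s Q = _ , cutA x ◅ ε
    cross-run (inj₂ (port _ (here refl) P , x)) s Q = _ , cutA⊥ x ◅ ε
    cross-run (inj₁ (port Y (there i) P , x))   s Q = Q , pass↑ (cutΓ i) x ◅ ε
    cross-run (inj₂ (port Y (there j) P , x))   s Q = Q , pass↑ (cutΔ j) x ◅ ε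

    next-run : ∀ t s Q → on (port-of-token t) s Q ⇝ at-next (next t) s
    next-run t s Q = inner-run t s Q ⨾ λ Q′ → cross-run (inner t) s Q′

    orbit-run : ∀ {t o} → Reaches t o → ∀ s Q → on (port-of-token t) s Q ⇝ at (output o) s
    orbit-run {t} (_ , ε , last) s Q =
      subst (λ r → on (port-of-token t) s Q ⇝ at-next r s) last (next-run t s Q)
    orbit-run {t} (u , step ◅ steps , last) s Q =
      subst (λ r → on (port-of-token t) s Q ⇝ at-next r s) step (next-run t s Q) ⨾ λ Q′ →
      orbit-run (u , steps , last) s Q′

    start-run-side : ∀ {X k} (v : Split Γ Δ {X} k) N e s Q →
                     st X (concl k) N s Q ⇝ on (port-of-token (side-entry v N e)) s
    start-run-side (left i)  N e s Q = Q , pass↓ (cutΓ i) e ◅ ε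
    start-run-side (right j) N e s Q = Q , pass↓ (cutΔ j) e ◅ ε

    start-run : ∀ p e s Q → at {π = cut ρ σ} p s Q ⇝ on (port-of-token (start p e)) s
    start-run (port X k N) e s Q = start-run-side (split Γ k) N e s Q

    outcome : (p : Port (Γ ++ Δ)) (e : IsEntry p) → Σ Output (Reaches (start p e))
    outcome p e = reaches (start-source p e)

    behaviour : Behaviour (cut ρ σ)
    behaviour = record
      { exit           = λ p e → output (proj₁ (outcome p e))
      ; exit-isExit    = λ p e → output-isExit (proj₁ (outcome p e))
      ; exit-injective = exit-injective
      ; run            = λ p e s Q → start-run p e s Q ⨾ λ Q′ →
                                     orbit-run (proj₂ (outcome p e)) s Q′
      }
      where
        -- equal exits come from equal outputs, hence from equal sources
        exit-injective : ∀ {p p′} e e′ → output (proj₁ (outcome p e))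
                                       ≡ output (proj₁ (outcome p′ e′)) → p ≡ p′
        exit-injective {p} {p′} e e′ eq with outcome p e | outcome p′ e′ | eq
        ... | o , r | o′ , r′ | eq′ with output-injective o o′ eq′
        ...   | refl = start-injective e e′
                         (reaches-injective (start-source p e) (start-source p′ e′) r r′)

  behaviour : ∀ {Γ} (π : Proof Γ) → Behaviour π
  behaviour (ax A)       = axiom A
  behaviour (cut ρ σ)    = Cut.behaviour ρ σ (behaviour ρ) (behaviour σ)
  behaviour (par ρ)      = relay (par-relay ρ) (behaviour ρ)
  behaviour (ten ρ σ)    = tensor (behaviour ρ) (behaviour σ)
  behaviour (qr n U m ρ) = relay (qr-relay n U m ρ) (behaviour ρ)
  behaviour (ex Γ ρ)     = relay (ex-relay Γ ρ) (behaviour ρ)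

proposition3 : (QS : QStruct) {Γ : List Formula} (π : QMLL.Proof QS Γ)
    (S : QMLL.State QS π) → QMLL.Initial QS π S →
    Σ (QMLL.State QS π) (λ T → QMLL.Final QS π T × Star (QMLL.Step QS π) S T)
proposition3 QS {Γ} π (QMLL.st A _ N _ Q) (i , refl , refl , e) =
  at (exit p e) [] (proj₁ execution) ,
  (member (exit p e) , refl , refl , exit-isExit p e) ,
  proj₂ execution
  where
    open Execution QS
    open Behaviour (behaviour π)
    p : Port Γ
    p = port A i N
    execution : at p [] Q ⇝ at (exit p e) []
    execution = run p e [] Q
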